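{- If $a_3\geq 2$ and $a_3\equiv 0\bmod 2$, then the triple $(3,6,a_3)$ is perfect.
   Context: For a graph $G$, the $3$-neighbour bootstrap process starts from a set $A_0\subseteq V(G)$ and, for $t\ge1$, sets $A_t=A_{t-1}\cup\{v: |N_G(v)\cap A_{t-1}|\ge 3\}$; $A_0$ percolates if $\bigcup_t A_t=V(G)$. For positive integers $a_1,a_2,a_3$, $[a_1]\times[a_2]\times[a_3]$ denotes the grid graph (vertices adjacent iff they differ by exactly 1 in exactly one coordinate), and $m(a_1,a_2,a_3;3)$ is the minimum size of a percolating set for the $3$-neighbour process in it. A triple $(a_1,a_2,a_3)$ of positive integers is called perfect if $a_1a_2+a_1a_3+a_2a_3\equiv 0\pmod 3$ and $m(a_1,a_2,a_3;3)=\frac{a_1a_2+a_1a_3+a_2a_3}{3}$. -}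

module Defs where

open import Data.Nat using (ℕ; zero; suc; _+_; _*_; _≤_; ∣_-_∣)
open import Data.Nat.Divisibility using (_∣_)
open import Data.Nat.DivMod using (_/_)
open import Data.Fin using (Fin; toℕ)
open import Data.Product using (_×_; Σ; ∃; ∃-syntax; _,_)
open import Data.Sum using (_⊎_)
open import Data.List using (List; length)
open import Data.List.Membership.Propositional using (_∈_)
open import Data.List.Relation.Unary.Unique.Propositional using (Unique)
open import Relation.Binary.PropositionalEquality using (_≡_; _≢_)

Vertex : ℕ → ℕ → ℕ → Set
Vertex a₁ a₂ a₃ = Fin a₁ × Fin a₂ × Fin a₃

Adj : ∀ {a₁ a₂ a₃} → Vertex a₁ a₂ a₃ → Vertex a₁ a₂ a₃ → Set
Adj (x , y , z) (x' , y' , z') =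
    (∣ toℕ x - toℕ x' ∣ ≡ 1 × y ≡ y' × z ≡ z')
  ⊎ (x ≡ x' × ∣ toℕ y - toℕ y' ∣ ≡ 1 × z ≡ z')
  ⊎ (x ≡ x' × y ≡ y' × ∣ toℕ z - toℕ z' ∣ ≡ 1)

-- Infected A₀ t v  :  v ∈ A_t  in the 3-neighbour bootstrap process
-- started from A₀ (a finite set given as a list of vertices).
-- v ∈ A_{t+1} iff v ∈ A_t or v has at least 3 (pairwise distinct)
-- neighbours in A_t.
data Infected {a₁ a₂ a₃ : ℕ} (A₀ : List (Vertex a₁ a₂ a₃))
     : ℕ → Vertex a₁ a₂ a₃ → Set where
  initial : ∀ {v} → v ∈ A₀ → Infected A₀ zero v
  keep    : ∀ {t v} → Infected A₀ t v → Infected A₀ (suc t) v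
  grow    : ∀ {t v} (u₁ u₂ u₃ : Vertex a₁ a₂ a₃) →
            u₁ ≢ u₂ → u₁ ≢ u₃ → u₂ ≢ u₃ →
            Adj v u₁ → Adj v u₂ → Adj v u₃ →
            Infected A₀ t u₁ → Infected A₀ t u₂ → Infected A₀ t u₃ →
            Infected A₀ (suc t) v

Percolates : ∀ {a₁ a₂ a₃} → List (Vertex a₁ a₂ a₃) → Set
Percolates {a₁} {a₂} {a₃} A₀ = (v : Vertex a₁ a₂ a₃) → ∃[ t ] Infected A₀ t v

IsMinPercolatingSize : ℕ → ℕ → ℕ → ℕ → Set
IsMinPercolatingSize a₁ a₂ a₃ k =
    (Σ (List (Vertex a₁ a₂ a₃)) λ A → Unique A × Percolates A × length A ≡ k)
  × ((A : List (Vertex a₁ a₂ a₃)) → Unique A → Percolates A → k ≤ length A)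

σ₂ : ℕ → ℕ → ℕ → ℕ
σ₂ a₁ a₂ a₃ = a₁ * a₂ + a₁ * a₃ + a₂ * a₃

Perfect : ℕ → ℕ → ℕ → Set
Perfect a₁ a₂ a₃ =
  (3 ∣ σ₂ a₁ a₂ a₃) × IsMinPercolatingSize a₁ a₂ a₃ (σ₂ a₁ a₂ a₃ / 3)

-- Lower bound, for every box: order the vertices by the time τ at which they are first
-- infected.  A vertex v outside A has three neighbours u with τ u < τ v; charge each such
-- edge to its later endpoint v.  Every edge is charged at most once, so
-- 3abc ≤ 3|A| + #edges = 3|A| + 3abc − σ₂, that is σ₂ ≤ 3|A|.
--
-- Upper bound for the box 3 × 6 × 2(m+1): cut it into m+1 slabs of two layers, seed every slab
-- with the same six cells and add six cells at the bottom and the top, 6m + 12 = σ₂/3 in all.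
-- The infection first climbs, infecting a fixed 14-cell pattern (front) in the upper layer of
-- each slab; once the top slab is full it descends, filling each slab from the one above.
-- Every local step lives in a window of at most four layers and is certified by running the
-- process on that window; an adjacency-preserving embedding carries it into the box.

module Submission where

open import Defs
open import Data.Nat using (ℕ; zero; suc; pred; _+_; _*_; _∸_; _≤_; _<_; _≤′_; ≤′-refl; ≤′-step; _⊔_; _≟_; _≤?_; _<ᵇ_; _≡ᵇ_; ∣_-_∣; z≤n; s≤s; s≤s⁻¹; z<s; s<s)
open import Data.Nat.Properties
open import Data.Nat.DivMod using (_/_; _mod_; m<n⇒m%n≡m; m*n/n≡m)
open import Data.Nat.Divisibility using (_∣_; divides)
open import Data.Nat.Tactic.RingSolver using (solve-∀)
open import Data.Bool using (Bool; true; false; T; T?; _∨_; _∧_)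
open import Data.Unit using (tt)
open import Data.Empty using (⊥-elim)
open import Data.Fin using (Fin; zero; suc; toℕ; fromℕ<; punchOut; #_)
open import Data.Fin.Properties using (toℕ-fromℕ<; toℕ-injective; toℕ<n; any?; punchIn-punchOut; punchOut-injective) renaming (_≟_ to _≟ᶠ_)
open import Data.Vec using (Vec; []; _∷_) renaming (lookup to vlookup)
open import Data.Vec.Functional using (Vector; removeAt)
open import Algebra.Properties.CommutativeMonoid.Sum +-0-commutativeMonoid using (sum; sum-remove)
open import Data.Product using (_×_; _,_; ∃-syntax; proj₁; proj₂)
open import Data.Product.Properties using (≡-dec)
open import Data.Sum using (_⊎_; inj₁; inj₂; [_,_]′)
open import Data.List using (List; []; _∷_; length; map; _++_; filter; filterᵇ; deduplicate; allFin; cartesianProduct)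
open import Data.List.Properties using (length-deduplicate)
open import Data.List.Relation.Unary.All using (All; []; _∷_; lookup; tabulate) renaming (map to All-map)
open import Data.List.Relation.Unary.AllPairs using (_∷_)
open import Data.List.Relation.Unary.Any using (here; there)
open import Data.List.Relation.Unary.Unique.Propositional using (Unique)
open import Data.List.Relation.Unary.Unique.DecPropositional.Properties using (deduplicate-!)
open import Data.List.Membership.Propositional using (_∈_; _∉_)
open import Data.List.Membership.Propositional.Properties using (∈-filter⁻; ∈-deduplicate⁻; ∈-deduplicate⁺; ∈-map⁺; ∈-map⁻; ∈-++⁺ˡ; ∈-++⁺ʳ; ∈-++⁻; ∈-cartesianProduct⁺; ∈-allFin)
open import Function using (_∘_; id; Injective)
open import Relation.Nullary using (Dec; yes; no; ¬?; _×-dec_; _⊎-dec_)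
open import Relation.Nullary.Decidable using (map′)
open import Relation.Unary using (Decidable)
open import Relation.Binary.PropositionalEquality using (_≡_; _≢_; refl; sym; trans; cong; cong₂; subst; subst₂)

-- Bootstrap percolation on grids

Spanned : ∀ {a b c} → List (Vertex a b c) → Vertex a b c → Set
Spanned A v = ∃[ t ] Infected A t v

ThreeNeighbours : ∀ {a b c} → (Vertex a b c → Set) → Vertex a b c → Set
ThreeNeighbours P v = ∃[ u₁ ] ∃[ u₂ ] ∃[ u₃ ] (u₁ ≢ u₂ × u₁ ≢ u₃ × u₂ ≢ u₃) ×
                      (Adj v u₁ × Adj v u₂ × Adj v u₃) × (P u₁ × P u₂ × P u₃)

module _ {a b c} {A : List (Vertex a b c)} where

  infected-≤′ : ∀ {t t′ v} → t ≤′ t′ → Infected A t v → Infected A t′ v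
  infected-≤′ ≤′-refl i = i
  infected-≤′ (≤′-step t≤t′) i = keep (infected-≤′ t≤t′ i)

  infected-≤ : ∀ {t t′ v} → t ≤ t′ → Infected A t v → Infected A t′ v
  infected-≤ = infected-≤′ ∘ ≤⇒≤′

  spanned-grow : ∀ {v u₁ u₂ u₃} → u₁ ≢ u₂ → u₁ ≢ u₃ → u₂ ≢ u₃ →
                 Adj v u₁ → Adj v u₂ → Adj v u₃ →
                 Spanned A u₁ → Spanned A u₂ → Spanned A u₃ → Spanned A v
  spanned-grow {u₁ = u₁} {u₂} {u₃} u₁≢u₂ u₁≢u₃ u₂≢u₃ adj₁ adj₂ adj₃
               (t₁ , i₁) (t₂ , i₂) (t₃ , i₃) =
    suc t , grow u₁ u₂ u₃ u₁≢u₂ u₁≢u₃ u₂≢u₃ adj₁ adj₂ adj₃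
              (infected-≤ (≤-trans (m≤m⊔n t₁ t₂) (m≤m⊔n _ t₃)) i₁)
              (infected-≤ (≤-trans (m≤n⊔m t₁ t₂) (m≤m⊔n _ t₃)) i₂)
              (infected-≤ (m≤n⊔m (t₁ ⊔ t₂) t₃) i₃)
    where
    t : ℕ
    t = t₁ ⊔ t₂ ⊔ t₃

spanned-image : ∀ {a b c a′ b′ c′} {A : List (Vertex a b c)} {B : List (Vertex a′ b′ c′)}
                (ι : Vertex a b c → Vertex a′ b′ c′) → Injective _≡_ _≡_ ι →
                (∀ {u v} → Adj u v → Adj (ι u) (ι v)) → All (Spanned B ∘ ι) A →
                ∀ {t v} → Infected A t v → Spanned B (ι v)
spanned-image ι ι-inj ι-adj seeds (initial v∈A) = lookup seeds v∈A
spanned-image ι ι-inj ι-adj seeds (keep i) = spanned-image ι ι-inj ι-adj seeds i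
spanned-image ι ι-inj ι-adj seeds (grow u₁ u₂ u₃ u₁≢u₂ u₁≢u₃ u₂≢u₃ adj₁ adj₂ adj₃ i₁ i₂ i₃) =
  spanned-grow (u₁≢u₂ ∘ ι-inj) (u₁≢u₃ ∘ ι-inj) (u₂≢u₃ ∘ ι-inj) (ι-adj adj₁) (ι-adj adj₂) (ι-adj adj₃)
    (spanned-image ι ι-inj ι-adj seeds i₁) (spanned-image ι ι-inj ι-adj seeds i₂) (spanned-image ι ι-inj ι-adj seeds i₃)

∣toℕ-toℕ∣≡0⇒≡ : ∀ {n} {p q : Fin n} → ∣ toℕ p - toℕ q ∣ ≡ 0 → p ≡ q
∣toℕ-toℕ∣≡0⇒≡ = toℕ-injective ∘ ∣m-n∣≡0⇒m≡n

module Grid {a b c : ℕ} where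

  V : Set
  V = Vertex a b c

  _≟ᵥ_ : (u v : V) → Dec (u ≡ v)
  _≟ᵥ_ = ≡-dec _≟ᶠ_ (≡-dec _≟ᶠ_ _≟ᶠ_)

  open import Data.List.Membership.DecPropositional _≟ᵥ_ public using (_∈?_)

  distance : V → V → ℕ
  distance (x , y , z) (x′ , y′ , z′) = ∣ toℕ x - toℕ x′ ∣ + ∣ toℕ y - toℕ y′ ∣ + ∣ toℕ z - toℕ z′ ∣

  distance≡0⇒≡ : ∀ v u → distance v u ≡ 0 → v ≡ u
  distance≡0⇒≡ (x , y , z) (x′ , y′ , z′) d≡0 =
    cong₂ _,_ (∣toℕ-toℕ∣≡0⇒≡ (m+n≡0⇒m≡0 dx dxy≡0))
      (cong₂ _,_ (∣toℕ-toℕ∣≡0⇒≡ (m+n≡0⇒n≡0 dx dxy≡0)) (∣toℕ-toℕ∣≡0⇒≡ (m+n≡0⇒n≡0 (dx + dy) d≡0)))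
    where
    dx dy : ℕ
    dx = ∣ toℕ x - toℕ x′ ∣
    dy = ∣ toℕ y - toℕ y′ ∣
    dxy≡0 : dx + dy ≡ 0
    dxy≡0 = m+n≡0⇒m≡0 (dx + dy) d≡0

  distance≡1⇒adjacent : ∀ v u → distance v u ≡ 1 → Adj v u
  distance≡1⇒adjacent (x , y , z) (x′ , y′ , z′) d≡1
    with ∣ toℕ x - toℕ x′ ∣ in dx | ∣ toℕ y - toℕ y′ ∣ in dy | ∣ toℕ z - toℕ z′ ∣ in dz | d≡1
  ... | 1 | 0 | 0 | _ = inj₁ (refl , ∣toℕ-toℕ∣≡0⇒≡ dy , ∣toℕ-toℕ∣≡0⇒≡ dz)
  ... | 0 | 1 | 0 | _ = inj₂ (inj₁ (∣toℕ-toℕ∣≡0⇒≡ dx , refl , ∣toℕ-toℕ∣≡0⇒≡ dz))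
  ... | 0 | 0 | 1 | _ = inj₂ (inj₂ (∣toℕ-toℕ∣≡0⇒≡ dx , ∣toℕ-toℕ∣≡0⇒≡ dy , refl))
  ... | 0 | 0 | 0 | ()
  ... | 0 | 0 | suc (suc _) | ()
  ... | 0 | 1 | suc _ | ()
  ... | 0 | suc (suc _) | _ | ()
  ... | 1 | 0 | suc _ | ()
  ... | 1 | suc _ | _ | ()
  ... | suc (suc _) | _ | _ | ()

  adjacent⇒distance≡1 : ∀ v u → Adj v u → distance v u ≡ 1
  adjacent⇒distance≡1 (x , y , z) _ (inj₁ (d , refl , refl))
    rewrite d | ∣n-n∣≡0 (toℕ y) | ∣n-n∣≡0 (toℕ z) = refl
  adjacent⇒distance≡1 (x , y , z) _ (inj₂ (inj₁ (refl , d , refl)))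
    rewrite ∣n-n∣≡0 (toℕ x) | d | ∣n-n∣≡0 (toℕ z) = refl
  adjacent⇒distance≡1 (x , y , z) _ (inj₂ (inj₂ (refl , refl , d)))
    rewrite ∣n-n∣≡0 (toℕ x) | ∣n-n∣≡0 (toℕ y) | d = refl

  adjacent? : ∀ v u → Dec (Adj v u)
  adjacent? v u = map′ (distance≡1⇒adjacent v u) (adjacent⇒distance≡1 v u) (distance v u ≟ 1)

  ∃-vertex? : {P : V → Set} → (∀ v → Dec (P v)) → Dec (∃[ v ] P v)
  ∃-vertex? P? = map′ (λ (x , y , z , p) → (x , y , z) , p) (λ ((x , y , z) , p) → x , y , z , p)
                      (any? λ x → any? λ y → any? λ z → P? (x , y , z))

  three-neighbours? : {P : V → Set} → (∀ v → Dec (P v)) → ∀ v → Dec (ThreeNeighbours P v)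
  three-neighbours? P? v =
    ∃-vertex? λ u₁ → ∃-vertex? λ u₂ → ∃-vertex? λ u₃ →
      (¬? (u₁ ≟ᵥ u₂) ×-dec ¬? (u₁ ≟ᵥ u₃) ×-dec ¬? (u₂ ≟ᵥ u₃)) ×-dec
      (adjacent? v u₁ ×-dec adjacent? v u₂ ×-dec adjacent? v u₃) ×-dec (P? u₁ ×-dec P? u₂ ×-dec P? u₃)

  infected? : ∀ (A : List V) t v → Dec (Infected A t v)
  infected? A zero v = map′ initial (λ { (initial v∈A) → v∈A }) (v ∈? A)
  infected? A (suc t) v = map′ [ keep , grown ]′ split (infected? A t v ⊎-dec three-neighbours? (infected? A t) v)
    where
    grown : ThreeNeighbours (Infected A t) v → Infected A (suc t) v
    grown (u₁ , u₂ , u₃ , (u₁≢u₂ , u₁≢u₃ , u₂≢u₃) , (adj₁ , adj₂ , adj₃) , (i₁ , i₂ , i₃)) =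
      grow u₁ u₂ u₃ u₁≢u₂ u₁≢u₃ u₂≢u₃ adj₁ adj₂ adj₃ i₁ i₂ i₃
    split : Infected A (suc t) v → Infected A t v ⊎ ThreeNeighbours (Infected A t) v
    split (keep i) = inj₁ i
    split (grow u₁ u₂ u₃ u₁≢u₂ u₁≢u₃ u₂≢u₃ adj₁ adj₂ adj₃ i₁ i₂ i₃) =
      inj₂ (u₁ , u₂ , u₃ , (u₁≢u₂ , u₁≢u₃ , u₂≢u₃) , (adj₁ , adj₂ , adj₃) , (i₁ , i₂ , i₃))

-- Certified closure of a seed set

module Closure {a b c : ℕ} where

  open Grid {a} {b} {c}

  -- Boolean tests, evaluated by the type checker in spanned-by-closure; normalising
  -- Dec-valued tests would also build their proofs.

  _∈ᵇ_ : V → List V → Bool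
  v ∈ᵇ [] = false
  v ∈ᵇ (u ∷ S) = (distance v u ≡ᵇ 0) ∨ (v ∈ᵇ S)

  ∈ᵇ⇒∈ : ∀ {v} S → T (v ∈ᵇ S) → v ∈ S
  ∈ᵇ⇒∈ {v} (u ∷ S) v∈S with distance v u ≡ᵇ 0 in eq
  ... | true = here (distance≡0⇒≡ v u (≡ᵇ⇒≡ _ 0 (subst T (sym eq) tt)))
  ... | false = there (∈ᵇ⇒∈ S v∈S)

  _⊆ᵇ_ : List V → List V → Bool
  [] ⊆ᵇ S = true
  (v ∷ B) ⊆ᵇ S = v ∈ᵇ S ∧ B ⊆ᵇ S

  ⊆ᵇ⇒⊆ : ∀ B {S} → T (B ⊆ᵇ S) → All (_∈ S) B
  ⊆ᵇ⇒⊆ [] _ = []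
  ⊆ᵇ⇒⊆ (v ∷ B) {S} B⊆S with v ∈ᵇ S in eq
  ... | true = ∈ᵇ⇒∈ S (subst T (sym eq) tt) ∷ ⊆ᵇ⇒⊆ B B⊆S
  ... | false = ⊥-elim B⊆S

  vertices : List V
  vertices = cartesianProduct (allFin a) (cartesianProduct (allFin b) (allFin c))

  neighboursIn : List V → V → List V
  neighboursIn S v = deduplicate _≟ᵥ_ (filterᵇ (λ u → distance v u ≡ᵇ 1) S)

  -- The membership test only keeps S free of repetitions; soundness rests on the count alone.
  sweep : List V → List V → List V
  sweep [] S = S
  sweep (v ∷ vs) S with v ∈ᵇ S | 2 <ᵇ length (neighboursIn S v)
  ... | false | true = sweep vs (v ∷ S)
  ... | _     | _    = sweep vs S

  close : ℕ → List V → List V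
  close zero S = S
  close (suc k) S = close k (sweep vertices S)

  module _ {A : List V} where

    spanned-from-neighbours : ∀ {v} (ns : List V) → Unique ns → 3 ≤ length ns →
                              All (λ u → Adj v u × Spanned A u) ns → Spanned A v
    spanned-from-neighbours (u₁ ∷ u₂ ∷ u₃ ∷ _) ((u₁≢u₂ ∷ u₁≢u₃ ∷ _) ∷ (u₂≢u₃ ∷ _) ∷ _) _
                            ((adj₁ , s₁) ∷ (adj₂ , s₂) ∷ (adj₃ , s₃) ∷ _) =
      spanned-grow u₁≢u₂ u₁≢u₃ u₂≢u₃ adj₁ adj₂ adj₃ s₁ s₂ s₃
    spanned-from-neighbours [] _ () _
    spanned-from-neighbours (_ ∷ []) _ (s≤s ()) _
    spanned-from-neighbours (_ ∷ _ ∷ []) _ (s≤s (s≤s ())) _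

    neighboursIn-spanned : ∀ {S} v → All (Spanned A) S → All (λ u → Adj v u × Spanned A u) (neighboursIn S v)
    neighboursIn-spanned {S} v spans = tabulate λ u∈ →
      let u∈S , near = ∈-filter⁻ (T? ∘ (λ u → distance v u ≡ᵇ 1)) (∈-deduplicate⁻ _≟ᵥ_ _ u∈)
      in distance≡1⇒adjacent v _ (≡ᵇ⇒≡ _ 1 near) , lookup spans u∈S

    sweep-spanned : ∀ vs {S} → All (Spanned A) S → All (Spanned A) (sweep vs S)
    sweep-spanned [] spans = spans
    sweep-spanned (v ∷ vs) {S} spans
      with v ∈ᵇ S | 2 <ᵇ length (neighboursIn S v) in three
    ... | false | true  = sweep-spanned vs (spanned-from-neighbours (neighboursIn S v) (deduplicate-! _≟ᵥ_ _)
                            (<ᵇ⇒< 2 _ (subst T (sym three) tt)) (neighboursIn-spanned v spans) ∷ spans)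
    ... | false | false = sweep-spanned vs spans
    ... | true  | _     = sweep-spanned vs spans

    close-spanned : ∀ k {S} → All (Spanned A) S → All (Spanned A) (close k S)
    close-spanned zero spans = spans
    close-spanned (suc k) spans = close-spanned k (sweep-spanned vertices spans)

  spanned-by-closure : ∀ k {A B : List V} → T (B ⊆ᵇ close k A) → All (Spanned A) B
  spanned-by-closure k {A} {B} B⊆closure =
    All-map (lookup (close-spanned k (tabulate λ v∈A → 0 , initial v∈A))) (⊆ᵇ⇒⊆ B B⊆closure)

-- Least witnesses and finite sums

Least : (ℕ → Set) → Set
Least P = ∃[ n ] (P n × ∀ {m} → P m → n ≤ m)

least : ∀ {P : ℕ → Set} → Decidable P → ∀ {n} → P n → Least P
least {P} P? {n} p = least-below n (n , ≤-refl , p)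
  where
  least-below : ∀ n → ∃[ k ] (k ≤ n × P k) → Least P
  least-below zero (.0 , z≤n , p₀) = 0 , p₀ , λ _ → z≤n
  least-below (suc n) (k , k≤n , pₖ) with anyUpTo? P? (suc n)
  ... | yes (j , j<n , pⱼ) = least-below n (j , s≤s⁻¹ j<n , pⱼ)
  ... | no none = k , pₖ , λ {j} pⱼ → ≮⇒≥ λ j<k → none (j , <-≤-trans j<k k≤n , pⱼ)

∑ : ℕ → (ℕ → ℕ) → ℕ
∑ zero f = 0
∑ (suc n) f = f 0 + ∑ n (f ∘ suc)

syntax ∑ n (λ i → e) = ∑[ i < n ] e

∑-cong : ∀ n {f g : ℕ → ℕ} → (∀ i → i < n → f i ≡ g i) → ∑ n f ≡ ∑ n g
∑-cong zero _ = refl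
∑-cong (suc n) f≡g = cong₂ _+_ (f≡g 0 z<s) (∑-cong n λ i i<n → f≡g (suc i) (s<s i<n))

∑-mono : ∀ n {f g : ℕ → ℕ} → (∀ i → i < n → f i ≤ g i) → ∑ n f ≤ ∑ n g
∑-mono zero _ = z≤n
∑-mono (suc n) f≤g = +-mono-≤ (f≤g 0 z<s) (∑-mono n λ i i<n → f≤g (suc i) (s<s i<n))

∑-+ : ∀ n (f g : ℕ → ℕ) → ∑[ i < n ] (f i + g i) ≡ ∑ n f + ∑ n g
∑-+ zero f g = refl
∑-+ (suc n) f g rewrite ∑-+ n (f ∘ suc) (g ∘ suc) = +-+-comm (f 0) (g 0) _ _
  where
  +-+-comm : ∀ w x y z → w + x + (y + z) ≡ w + y + (x + z)
  +-+-comm = solve-∀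

∑-*ˡ : ∀ n k (f : ℕ → ℕ) → ∑[ i < n ] (k * f i) ≡ k * ∑ n f
∑-*ˡ zero k f = sym (*-zeroʳ k)
∑-*ˡ (suc n) k f rewrite ∑-*ˡ n k (f ∘ suc) = sym (*-distribˡ-+ k (f 0) _)

∑-const : ∀ n k → ∑[ i < n ] k ≡ n * k
∑-const zero k = refl
∑-const (suc n) k = cong (k +_) (∑-const n k)

∑-≤-const : ∀ n {f : ℕ → ℕ} {k} → (∀ i → f i ≤ k) → ∑ n f ≤ n * k
∑-≤-const n {k = k} f≤k = subst (_ ≤_) (∑-const n k) (∑-mono n λ i _ → f≤k i)

∑-swap : ∀ m n (f : ℕ → ℕ → ℕ) → ∑[ i < m ] ∑[ j < n ] f i j ≡ ∑[ j < n ] ∑[ i < m ] f i j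
∑-swap zero n f = sym (trans (∑-const n 0) (*-zeroʳ n))
∑-swap (suc m) n f = trans (cong (∑ n (f 0) +_) (∑-swap m n (f ∘ suc)))
                           (sym (∑-+ n (f 0) λ j → ∑[ i < m ] f (suc i) j))

𝟙 : Bool → ℕ
𝟙 true = 1
𝟙 false = 0

𝟙-T : ∀ {b} → T b → 𝟙 b ≡ 1
𝟙-T {true} _ = refl

∑-indicator : ∀ n p (f : ℕ → ℕ) → ∑[ i < n ] (𝟙 (p ≡ᵇ i) * f i) ≤ f p
∑-indicator zero p f = z≤n
∑-indicator (suc n) zero f =
  ≤-reflexive (trans (cong₂ _+_ (+-identityʳ (f 0)) (trans (∑-const n 0) (*-zeroʳ n))) (+-identityʳ (f 0)))
∑-indicator (suc n) (suc p) f = ∑-indicator n p (f ∘ suc)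

∑³ : ℕ → ℕ → ℕ → (ℕ → ℕ → ℕ → ℕ) → ℕ
∑³ a b c f = ∑[ i < a ] ∑[ j < b ] ∑[ k < c ] f i j k

∑³-+ : ∀ a b c f g → ∑³ a b c (λ i j k → f i j k + g i j k) ≡ ∑³ a b c f + ∑³ a b c g
∑³-+ a b c f g = trans (∑-cong a λ i _ → trans (∑-cong b λ j _ → ∑-+ c (f i j) (g i j)) (∑-+ b _ _)) (∑-+ a _ _)

∑³-*ˡ : ∀ a b c n f → ∑³ a b c (λ i j k → n * f i j k) ≡ n * ∑³ a b c f
∑³-*ˡ a b c n f = trans (∑-cong a λ i _ → trans (∑-cong b λ j _ → ∑-*ˡ c n (f i j)) (∑-*ˡ b n _)) (∑-*ˡ a n _)

∑³-mono : ∀ a b c {f g} → (∀ i j k → i < a → j < b → k < c → f i j k ≤ g i j k) → ∑³ a b c f ≤ ∑³ a b c g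
∑³-mono a b c f≤g = ∑-mono a λ i i<a → ∑-mono b λ j j<b → ∑-mono c λ k k<c → f≤g i j k i<a j<b k<c

∑³-const : ∀ a b c n → ∑³ a b c (λ _ _ _ → n) ≡ a * (b * (c * n))
∑³-const a b c n = trans (∑-cong a λ _ _ → trans (∑-cong b λ _ _ → ∑-const c n) (∑-const b _)) (∑-const a _)

indicator : ℕ × ℕ × ℕ → ℕ → ℕ → ℕ → ℕ
indicator (x , y , z) i j k = 𝟙 (x ≡ᵇ i) * (𝟙 (y ≡ᵇ j) * 𝟙 (z ≡ᵇ k))

𝟙-≡ᵇ-refl : ∀ n → 𝟙 (n ≡ᵇ n) ≡ 1
𝟙-≡ᵇ-refl n = 𝟙-T (≡⇒≡ᵇ n n refl)

∑³-indicator : ∀ a b c p → ∑³ a b c (indicator p) ≤ 1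
∑³-indicator a b c (x , y , z) = begin
    ∑³ a b c (indicator (x , y , z))
  ≡⟨ ∑-cong a (λ i _ → trans (∑-cong b λ j _ → inner i j) (∑-*ˡ b (𝟙 (x ≡ᵇ i)) λ j → 𝟙 (y ≡ᵇ j) * Z)) ⟩
    ∑[ i < a ] (𝟙 (x ≡ᵇ i) * ∑[ j < b ] (𝟙 (y ≡ᵇ j) * Z))
  ≤⟨ ∑-indicator a x (λ _ → ∑[ j < b ] (𝟙 (y ≡ᵇ j) * Z)) ⟩
    ∑[ j < b ] (𝟙 (y ≡ᵇ j) * Z)
  ≤⟨ ∑-indicator b y (λ _ → Z) ⟩
    Z
  ≡⟨ ∑-cong c (λ k _ → *-identityʳ (𝟙 (z ≡ᵇ k))) ⟨
    ∑[ k < c ] (𝟙 (z ≡ᵇ k) * 1)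
  ≤⟨ ∑-indicator c z (λ _ → 1) ⟩
    1 ∎
  where
  open ≤-Reasoning
  Z : ℕ
  Z = ∑[ k < c ] 𝟙 (z ≡ᵇ k)
  inner : ∀ i j → ∑[ k < c ] indicator (x , y , z) i j k ≡ 𝟙 (x ≡ᵇ i) * (𝟙 (y ≡ᵇ j) * Z)
  inner i j = trans (∑-*ˡ c (𝟙 (x ≡ᵇ i)) (λ k → 𝟙 (y ≡ᵇ j) * 𝟙 (z ≡ᵇ k)))
                    (cong (𝟙 (x ≡ᵇ i) *_) (∑-*ˡ c (𝟙 (y ≡ᵇ j)) λ k → 𝟙 (z ≡ᵇ k)))

entry≤sum : ∀ {n} (t : Vector ℕ n) i → t i ≤ sum t
entry≤sum {suc n} t i = subst (t i ≤_) (sym (sum-remove {i = i} t)) (m≤m+n _ _)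

two-entries≤sum : ∀ {n} (t : Vector ℕ n) {i j} → i ≢ j → t i + t j ≤ sum t
two-entries≤sum {suc n} t {i} {j} i≢j = begin
    t i + t j
  ≡⟨ cong (λ k → t i + t k) (punchIn-punchOut i≢j) ⟨
    t i + removeAt t i (punchOut i≢j)
  ≤⟨ +-monoʳ-≤ (t i) (entry≤sum (removeAt t i) _) ⟩
    t i + sum (removeAt t i)
  ≡⟨ sum-remove t ⟨
    sum t ∎
  where open ≤-Reasoning

three-entries≤sum : ∀ {n} (t : Vector ℕ n) {i j k} → i ≢ j → i ≢ k → j ≢ k → t i + (t j + t k) ≤ sum t
three-entries≤sum {suc n} t {i} {j} {k} i≢j i≢k j≢k = begin
    t i + (t j + t k)
  ≡⟨ cong₂ (λ j k → t i + (t j + t k)) (punchIn-punchOut i≢j) (punchIn-punchOut i≢k) ⟨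
    t i + (removeAt t i (punchOut i≢j) + removeAt t i (punchOut i≢k))
  ≤⟨ +-monoʳ-≤ (t i) (two-entries≤sum (removeAt t i) (j≢k ∘ punchOut-injective i≢j i≢k)) ⟩
    t i + sum (removeAt t i)
  ≡⟨ sum-remove t ⟨
    sum t ∎
  where open ≤-Reasoning

-- The lower bound

-- Along a line of L cells infected at times f 0, f 1, …, cell i is charged for each
-- neighbour infected strictly before it; each of the L ∸ 1 edges is charged at most once.

earlier : ℕ → ℕ → ℕ
earlier s t = 𝟙 (s <ᵇ t)

before : (ℕ → ℕ) → ℕ → ℕ
before f zero = 0
before f (suc i) = earlier (f i) (f (suc i))

after : ℕ → (ℕ → ℕ) → ℕ → ℕ
after L f i = 𝟙 (suc i <ᵇ L) * earlier (f (suc i)) (f i)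

earlier-< : ∀ {s t} → s < t → earlier s t ≡ 1
earlier-< s<t = 𝟙-T (<⇒<ᵇ s<t)

earlier-asym : ∀ s t → earlier s t + earlier t s ≤ 1
earlier-asym s t with s <ᵇ t in s<t | t <ᵇ s in t<s
... | true | true = ⊥-elim (<-asym (<ᵇ⇒< s t (subst T (sym s<t) tt)) (<ᵇ⇒< t s (subst T (sym t<s) tt)))
... | true | false = ≤-refl
... | false | true = ≤-refl
... | false | false = z≤n

line-bound : ∀ L (f : ℕ → ℕ) → ∑[ i < suc L ] (before f i + after (suc L) f i) ≤ L
line-bound zero f = z≤n
line-bound (suc L) f = begin
    ∑[ i < suc (suc L) ] (before f i + after (suc (suc L)) f i)
  ≡⟨ regroup (earlier (f 1) (f 0)) (earlier (f 0) (f 1)) (after (suc L) (f ∘ suc) 0) _ ⟩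
    (earlier (f 1) (f 0) + earlier (f 0) (f 1)) + ∑[ i < suc L ] (before (f ∘ suc) i + after (suc L) (f ∘ suc) i)
  ≤⟨ +-mono-≤ (earlier-asym (f 1) (f 0)) (line-bound L (f ∘ suc)) ⟩
    suc L ∎
  where
  open ≤-Reasoning
  regroup : ∀ p q r s → (0 + (p + 0)) + ((q + r) + s) ≡ (p + q) + ((0 + r) + s)
  regroup = solve-∀

∣-∣≡1⇒≡suc : ∀ m n → ∣ m - n ∣ ≡ 1 → m ≡ suc n ⊎ n ≡ suc m
∣-∣≡1⇒≡suc zero zero ()
∣-∣≡1⇒≡suc zero (suc n) d = inj₂ d
∣-∣≡1⇒≡suc (suc m) zero d = inj₁ d
∣-∣≡1⇒≡suc (suc m) (suc n) d with ∣-∣≡1⇒≡suc m n d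
... | inj₁ m≡n+1 = inj₁ (cong suc m≡n+1)
... | inj₂ n≡m+1 = inj₂ (cong suc n≡m+1)

line-neighbour : ∀ L (f : ℕ → ℕ) {p p′} → p′ < L → ∣ p - p′ ∣ ≡ 1 → f p′ < f p →
                 (p ≡ suc p′ × 1 ≤ before f p) ⊎ (p′ ≡ suc p × 1 ≤ after L f p)
line-neighbour L f {p} {p′} p′<L dist later with ∣-∣≡1⇒≡suc p p′ dist
... | inj₁ refl = inj₁ (refl , ≤-reflexive (sym (earlier-< later)))
... | inj₂ refl rewrite 𝟙-T (<⇒<ᵇ p′<L) | earlier-< later = inj₂ (refl , ≤-refl)

toℕ-mod : ∀ {n} (x : Fin (suc n)) → toℕ x mod suc n ≡ x
toℕ-mod x = toℕ-injective (trans (toℕ-fromℕ< _) (m<n⇒m%n≡m (toℕ<n x)))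

coordinates : ∀ {a b c} → Vertex a b c → ℕ × ℕ × ℕ
coordinates (x , y , z) = toℕ x , toℕ y , toℕ z

coordinates-injective : ∀ {a b c} {u v : Vertex a b c} → coordinates u ≡ coordinates v → u ≡ v
coordinates-injective {u = x , y , z} {x′ , y′ , z′} eq =
  cong₂ _,_ (toℕ-injective (cong proj₁ eq))
    (cong₂ _,_ (toℕ-injective (cong (proj₁ ∘ proj₂) eq)) (toℕ-injective (cong (proj₂ ∘ proj₂) eq)))

step : Fin 6 → ℕ × ℕ × ℕ → ℕ × ℕ × ℕ
step zero (i , j , k) = pred i , j , k
step (suc zero) (i , j , k) = suc i , j , k
step (suc (suc zero)) (i , j , k) = i , pred j , k
step (suc (suc (suc zero))) (i , j , k) = i , suc j , k
step (suc (suc (suc (suc zero)))) (i , j , k) = i , j , pred k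
step (suc (suc (suc (suc (suc zero))))) (i , j , k) = i , j , suc k

occurrences : ∀ {a b c} → List (Vertex a b c) → ℕ → ℕ → ℕ → ℕ
occurrences [] i j k = 0
occurrences (u ∷ us) i j k = indicator (coordinates u) i j k + occurrences us i j k

∑³-occurrences : ∀ {a b c} p q r (us : List (Vertex a b c)) → ∑³ p q r (occurrences us) ≤ length us
∑³-occurrences p q r [] rewrite ∑³-const p q r 0 | *-zeroʳ r | *-zeroʳ q | *-zeroʳ p = z≤n
∑³-occurrences p q r (u ∷ us) = begin
    ∑³ p q r (occurrences (u ∷ us))
  ≡⟨ ∑³-+ p q r (indicator (coordinates u)) (occurrences us) ⟩
    ∑³ p q r (indicator (coordinates u)) + ∑³ p q r (occurrences us)
  ≤⟨ +-mono-≤ (∑³-indicator p q r (coordinates u)) (∑³-occurrences p q r us) ⟩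
    suc (length us) ∎
  where open ≤-Reasoning

occurrences-∈ : ∀ {a b c} {v : Vertex a b c} {us} → v ∈ us →
                let (i , j , k) = coordinates v in 1 ≤ occurrences us i j k
occurrences-∈ {v = x , y , z} (here refl)
  rewrite 𝟙-≡ᵇ-refl (toℕ x) | 𝟙-≡ᵇ-refl (toℕ y) | 𝟙-≡ᵇ-refl (toℕ z) = s≤s z≤n
occurrences-∈ {us = _ ∷ us} (there v∈us) = ≤-trans (occurrences-∈ v∈us) (m≤n+m _ _)

module FirstInfection {a b c : ℕ} (A : List (Vertex a b c)) (percolates : Percolates A) where

  first : ∀ v → Least (λ t → Infected A t v)
  first v = least (λ t → Grid.infected? A t v) (proj₂ (percolates v))

  τ : Vertex a b c → ℕ
  τ v = proj₁ (first v)

  τ-minimal : ∀ {t v} → Infected A t v → τ v ≤ t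
  τ-minimal {v = v} = proj₂ (proj₂ (first v))

  earlier-neighbours : ∀ {v} → v ∉ A → ThreeNeighbours (λ u → τ u < τ v) v
  earlier-neighbours {v} v∉A = at-first (proj₁ (proj₂ (first v))) τ-minimal
    where
    at-first : ∀ {t} → Infected A t v → (∀ {t′} → Infected A t′ v → t ≤ t′) →
               ThreeNeighbours (λ u → τ u < t) v
    at-first (initial v∈A) _ = ⊥-elim (v∉A v∈A)
    at-first (keep i) minimal = ⊥-elim (1+n≰n (minimal i))
    at-first (grow u₁ u₂ u₃ u₁≢u₂ u₁≢u₃ u₂≢u₃ adj₁ adj₂ adj₃ i₁ i₂ i₃) _ =
      u₁ , u₂ , u₃ , (u₁≢u₂ , u₁≢u₃ , u₂≢u₃) , (adj₁ , adj₂ , adj₃) ,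
      (s≤s (τ-minimal i₁) , s≤s (τ-minimal i₂) , s≤s (τ-minimal i₃))

module LowerBound {a b c : ℕ} (A : List (Vertex (suc a) (suc b) (suc c))) (percolates : Percolates A) where

  open FirstInfection A percolates
  open Grid {suc a} {suc b} {suc c} using (_∈?_)

  ∑ᵍ : (ℕ → ℕ → ℕ → ℕ) → ℕ
  ∑ᵍ = ∑³ (suc a) (suc b) (suc c)

  τ̂ : ℕ → ℕ → ℕ → ℕ
  τ̂ i j k = τ (i mod suc a , j mod suc b , k mod suc c)

  τ̂-toℕ : ∀ x y z → τ̂ (toℕ x) (toℕ y) (toℕ z) ≡ τ (x , y , z)
  τ̂-toℕ x y z rewrite toℕ-mod x | toℕ-mod y | toℕ-mod z = refl

  chargeˣ chargeʸ chargeᶻ : ℕ → ℕ → ℕ → ℕ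
  chargeˣ i j k = before (λ i → τ̂ i j k) i + after (suc a) (λ i → τ̂ i j k) i
  chargeʸ i j k = before (λ j → τ̂ i j k) j + after (suc b) (λ j → τ̂ i j k) j
  chargeᶻ i j k = before (λ k → τ̂ i j k) k + after (suc c) (λ k → τ̂ i j k) k

  charge : ℕ → ℕ → ℕ → ℕ
  charge i j k = chargeˣ i j k + chargeʸ i j k + chargeᶻ i j k

  charges : ℕ × ℕ × ℕ → Vector ℕ 6
  charges (i , j , k) zero = before (λ i → τ̂ i j k) i
  charges (i , j , k) (suc zero) = after (suc a) (λ i → τ̂ i j k) i
  charges (i , j , k) (suc (suc zero)) = before (λ j → τ̂ i j k) j
  charges (i , j , k) (suc (suc (suc zero))) = after (suc b) (λ j → τ̂ i j k) j
  charges (i , j , k) (suc (suc (suc (suc zero)))) = before (λ k → τ̂ i j k) k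
  charges (i , j , k) (suc (suc (suc (suc (suc zero))))) = after (suc c) (λ k → τ̂ i j k) k

  sum-charges : ∀ i j k → sum (charges (i , j , k)) ≡ charge i j k
  sum-charges i j k =
    regroup (before X i) (after (suc a) X i) (before Y j) (after (suc b) Y j) (before Z k) (after (suc c) Z k)
    where
    X Y Z : ℕ → ℕ
    X i = τ̂ i j k
    Y j = τ̂ i j k
    Z k = τ̂ i j k
    regroup : ∀ p q r s t u → p + (q + (r + (s + (t + (u + 0))))) ≡ p + q + (r + s) + (t + u)
    regroup = solve-∀

  charged-direction : ∀ {v u} → Adj v u → τ u < τ v →
                      ∃[ d ] (coordinates u ≡ step d (coordinates v) × 1 ≤ charges (coordinates v) d)
  charged-direction {x , y , z} {x′ , _ , _} (inj₁ (d , refl , refl)) earlier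
    with line-neighbour (suc a) (λ i → τ̂ i (toℕ y) (toℕ z)) (toℕ<n x′) d
           (subst₂ _<_ (sym (τ̂-toℕ x′ y z)) (sym (τ̂-toℕ x y z)) earlier)
  ... | inj₁ (x≡ , c) = zero , cong (λ i → pred i , toℕ y , toℕ z) (sym x≡) , c
  ... | inj₂ (x′≡ , c) = suc zero , cong (λ i → i , toℕ y , toℕ z) x′≡ , c
  charged-direction {x , y , z} {_ , y′ , _} (inj₂ (inj₁ (refl , d , refl))) earlier
    with line-neighbour (suc b) (λ j → τ̂ (toℕ x) j (toℕ z)) (toℕ<n y′) d
           (subst₂ _<_ (sym (τ̂-toℕ x y′ z)) (sym (τ̂-toℕ x y z)) earlier)
  ... | inj₁ (y≡ , c) = suc (suc zero) , cong (λ j → toℕ x , pred j , toℕ z) (sym y≡) , c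
  ... | inj₂ (y′≡ , c) = suc (suc (suc zero)) , cong (λ j → toℕ x , j , toℕ z) y′≡ , c
  charged-direction {x , y , z} {_ , _ , z′} (inj₂ (inj₂ (refl , refl , d))) earlier
    with line-neighbour (suc c) (λ k → τ̂ (toℕ x) (toℕ y) k) (toℕ<n z′) d
           (subst₂ _<_ (sym (τ̂-toℕ x y z′)) (sym (τ̂-toℕ x y z)) earlier)
  ... | inj₁ (z≡ , c) = suc (suc (suc (suc zero))) , cong (λ k → toℕ x , toℕ y , pred k) (sym z≡) , c
  ... | inj₂ (z′≡ , c) = suc (suc (suc (suc (suc zero)))) , cong (λ k → toℕ x , toℕ y , k) z′≡ , c

  three≤charges : ∀ {v} → v ∉ A → 3 ≤ sum (charges (coordinates v))
  three≤charges {v} v∉A with earlier-neighbours v∉A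
  ... | u₁ , u₂ , u₃ , (u₁≢u₂ , u₁≢u₃ , u₂≢u₃) , (adj₁ , adj₂ , adj₃) , (e₁ , e₂ , e₃)
    with charged-direction adj₁ e₁ | charged-direction adj₂ e₂ | charged-direction adj₃ e₃
  ... | d₁ , s₁ , c₁ | d₂ , s₂ , c₂ | d₃ , s₃ , c₃ =
    ≤-trans (+-mono-≤ c₁ (+-mono-≤ c₂ c₃))
      (three-entries≤sum (charges (coordinates v))
        (distinct s₁ s₂ u₁≢u₂) (distinct s₁ s₃ u₁≢u₃) (distinct s₂ s₃ u₂≢u₃))
    where
    distinct : ∀ {d d′ u u′} → coordinates u ≡ step d (coordinates v) → coordinates u′ ≡ step d′ (coordinates v) →
               u ≢ u′ → d ≢ d′
    distinct su su′ u≢u′ refl = u≢u′ (coordinates-injective (trans su (sym su′)))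

  PointBound : ℕ × ℕ × ℕ → Set
  PointBound (i , j , k) = 3 ≤ 3 * occurrences A i j k + charge i j k

  vertex-bound : ∀ v → PointBound (coordinates v)
  vertex-bound v@(x , y , z) with v ∈? A
  ... | yes v∈A = ≤-trans (*-monoʳ-≤ 3 (occurrences-∈ v∈A)) (m≤m+n _ _)
  ... | no v∉A = ≤-trans (subst (3 ≤_) (sum-charges (toℕ x) (toℕ y) (toℕ z)) (three≤charges v∉A))
                         (m≤n+m _ (3 * occurrences A (toℕ x) (toℕ y) (toℕ z)))

  point-bound : ∀ i j k → i < suc a → j < suc b → k < suc c → PointBound (i , j , k)
  point-bound i j k i<a j<b k<c = subst PointBound coordinates≡ (vertex-bound (fromℕ< i<a , fromℕ< j<b , fromℕ< k<c))
    where
    coordinates≡ : coordinates (fromℕ< i<a , fromℕ< j<b , fromℕ< k<c) ≡ (i , j , k)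
    coordinates≡ = cong₂ _,_ (toℕ-fromℕ< i<a) (cong₂ _,_ (toℕ-fromℕ< j<b) (toℕ-fromℕ< k<c))

  ∑ᵍ-chargeˣ : ∑ᵍ chargeˣ ≤ suc b * (suc c * a)
  ∑ᵍ-chargeˣ = begin
      ∑ᵍ chargeˣ
    ≡⟨ ∑-swap (suc a) (suc b) (λ i j → ∑[ k < suc c ] chargeˣ i j k) ⟩
      ∑[ j < suc b ] ∑[ i < suc a ] ∑[ k < suc c ] chargeˣ i j k
    ≡⟨ ∑-cong (suc b) (λ j _ → ∑-swap (suc a) (suc c) λ i k → chargeˣ i j k) ⟩
      ∑[ j < suc b ] ∑[ k < suc c ] ∑[ i < suc a ] chargeˣ i j k
    ≤⟨ ∑-≤-const (suc b) (λ j → ∑-≤-const (suc c) λ k → line-bound a λ i → τ̂ i j k) ⟩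
      suc b * (suc c * a) ∎
    where open ≤-Reasoning

  ∑ᵍ-chargeʸ : ∑ᵍ chargeʸ ≤ suc a * (suc c * b)
  ∑ᵍ-chargeʸ = begin
      ∑ᵍ chargeʸ
    ≡⟨ ∑-cong (suc a) (λ i _ → ∑-swap (suc b) (suc c) λ j k → chargeʸ i j k) ⟩
      ∑[ i < suc a ] ∑[ k < suc c ] ∑[ j < suc b ] chargeʸ i j k
    ≤⟨ ∑-≤-const (suc a) (λ i → ∑-≤-const (suc c) λ k → line-bound b λ j → τ̂ i j k) ⟩
      suc a * (suc c * b) ∎
    where open ≤-Reasoning

  ∑ᵍ-chargeᶻ : ∑ᵍ chargeᶻ ≤ suc a * (suc b * c)
  ∑ᵍ-chargeᶻ = ∑-≤-const (suc a) λ i → ∑-≤-const (suc b) λ j → line-bound c λ k → τ̂ i j k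

  edges : ℕ
  edges = suc b * (suc c * a) + suc a * (suc c * b) + suc a * (suc b * c)

  ∑ᵍ-charge : ∑ᵍ charge ≤ edges
  ∑ᵍ-charge = begin
      ∑ᵍ charge
    ≡⟨ trans (∑³-+ (suc a) (suc b) (suc c) (λ i j k → chargeˣ i j k + chargeʸ i j k) chargeᶻ)
             (cong (_+ ∑ᵍ chargeᶻ) (∑³-+ (suc a) (suc b) (suc c) chargeˣ chargeʸ)) ⟩
      ∑ᵍ chargeˣ + ∑ᵍ chargeʸ + ∑ᵍ chargeᶻ
    ≤⟨ +-mono-≤ (+-mono-≤ ∑ᵍ-chargeˣ ∑ᵍ-chargeʸ) ∑ᵍ-chargeᶻ ⟩
      edges ∎
    where open ≤-Reasoning

  counting-bound : suc a * (suc b * (suc c * 3)) ≤ 3 * length A + edges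
  counting-bound = begin
      suc a * (suc b * (suc c * 3))
    ≡⟨ ∑³-const (suc a) (suc b) (suc c) 3 ⟨
      ∑ᵍ (λ _ _ _ → 3)
    ≤⟨ ∑³-mono (suc a) (suc b) (suc c) point-bound ⟩
      ∑ᵍ (λ i j k → 3 * occurrences A i j k + charge i j k)
    ≡⟨ ∑³-+ (suc a) (suc b) (suc c) (λ i j k → 3 * occurrences A i j k) charge ⟩
      ∑ᵍ (λ i j k → 3 * occurrences A i j k) + ∑ᵍ charge
    ≡⟨ cong (_+ ∑ᵍ charge) (∑³-*ˡ (suc a) (suc b) (suc c) 3 (occurrences A)) ⟩
      3 * ∑ᵍ (occurrences A) + ∑ᵍ charge
    ≤⟨ +-mono-≤ (*-monoʳ-≤ 3 (∑³-occurrences (suc a) (suc b) (suc c) A)) ∑ᵍ-charge ⟩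
      3 * length A + edges ∎
    where open ≤-Reasoning

  σ₂≤length*3 : σ₂ (suc a) (suc b) (suc c) ≤ length A * 3
  σ₂≤length*3 = +-cancelʳ-≤ edges _ _ (begin
      σ₂ (suc a) (suc b) (suc c) + edges
    ≡⟨ box a b c ⟨
      suc a * (suc b * (suc c * 3))
    ≤⟨ counting-bound ⟩
      3 * length A + edges
    ≡⟨ cong (_+ edges) (*-comm 3 (length A)) ⟩
      length A * 3 + edges ∎)
    where
    open ≤-Reasoning
    box : ∀ a b c → suc a * (suc b * (suc c * 3)) ≡
                    suc a * suc b + suc a * suc c + suc b * suc c +
                    (suc b * (suc c * a) + suc a * (suc c * b) + suc a * (suc b * c))
    box = solve-∀

perfect : ∀ {a b c} (A : List (Vertex (suc a) (suc b) (suc c))) → Percolates A →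
          σ₂ (suc a) (suc b) (suc c) ≡ length A * 3 → Perfect (suc a) (suc b) (suc c)
perfect {a} {b} {c} A percolates σ₂≡ =
  divides (length A) σ₂≡ ,
  subst (IsMinPercolatingSize (suc a) (suc b) (suc c)) (sym (trans (cong (_/ 3) σ₂≡) (m*n/n≡m (length A) 3)))
    ((A′ , deduplicate-! _≟ᵥ_ A , percolates′ , length-A′) , λ B _ → minimal B)
  where
  open Grid {suc a} {suc b} {suc c} using (_≟ᵥ_)
  minimal : ∀ B → Percolates B → length A ≤ length B
  minimal B percolatesB =
    *-cancelʳ-≤ (length A) (length B) 3 (subst (_≤ length B * 3) σ₂≡ (LowerBound.σ₂≤length*3 B percolatesB))
  A′ : List (Vertex (suc a) (suc b) (suc c))
  A′ = deduplicate _≟ᵥ_ A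
  percolates′ : Percolates A′
  percolates′ v =
    spanned-image id id id (tabulate λ v∈A → 0 , initial (∈-deduplicate⁺ _≟ᵥ_ v∈A)) (proj₂ (percolates v))
  length-A′ : length A′ ≡ length A
  length-A′ = ≤-antisym (length-deduplicate _≟ᵥ_ A) (minimal A′ percolates′)

-- Windows of consecutive layers

Pattern : ℕ → ℕ → Set
Pattern a b = List (Fin a × Fin b)

module _ {a b : ℕ} where

  placeAt : ∀ {c} → Fin c → Fin a × Fin b → Vertex a b c
  placeAt z (x , y) = x , y , z

  raise : ∀ {c} → Vertex a b c → Vertex a b (suc c)
  raise (x , y , z) = x , y , suc z

  stack : ∀ {k} → Vec (Pattern a b) k → List (Vertex a b k)
  stack [] = []
  stack (p ∷ ps) = map (placeAt zero) p ++ map raise (stack ps)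

  ∈-stack⁺ : ∀ {k} (ps : Vec (Pattern a b) k) {x y} l → (x , y) ∈ vlookup ps l → (x , y , l) ∈ stack ps
  ∈-stack⁺ (p ∷ ps) zero xy∈ = ∈-++⁺ˡ (∈-map⁺ (placeAt zero) xy∈)
  ∈-stack⁺ (p ∷ ps) (suc l) xy∈ = ∈-++⁺ʳ (map (placeAt zero) p) (∈-map⁺ raise (∈-stack⁺ ps l xy∈))

  ∈-stack⁻ : ∀ {k} (ps : Vec (Pattern a b) k) {x y l} → (x , y , l) ∈ stack ps → (x , y) ∈ vlookup ps l
  ∈-stack⁻ (p ∷ ps) v∈ with ∈-++⁻ (map (placeAt zero) p) v∈
  ... | inj₁ v∈p with ∈-map⁻ (placeAt zero) v∈p
  ...   | _ , xy∈ , refl = xy∈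
  ∈-stack⁻ (p ∷ ps) v∈ | inj₂ v∈ps with ∈-map⁻ raise v∈ps
  ...   | (_ , _ , _) , v∈stack , refl = ∈-stack⁻ ps v∈stack

  -- ps and qs list, layer by layer from the bottom, the seeded cells and the cells they span.
  record Spreads {k} (ps qs : Vec (Pattern a b) k) : Set where
    constructor spreads
    field spanned : All (Spanned (stack ps)) (stack qs)

  LayerSpanned : ∀ {c} → List (Vertex a b c) → Pattern a b → ℕ → Set
  LayerSpanned A p n = ∀ {x y z} → toℕ z ≡ n → (x , y) ∈ p → Spanned A (x , y , z)

  LayersSpanned : ∀ {c k} → List (Vertex a b c) → ℕ → Vec (Pattern a b) k → Set
  LayersSpanned A b₀ ps = ∀ l → LayerSpanned A (vlookup ps l) (toℕ l + b₀)

  LayerSpanned-++ : ∀ {c} {A : List (Vertex a b c)} {p q n} →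
                    LayerSpanned A p n → LayerSpanned A q n → LayerSpanned A (p ++ q) n
  LayerSpanned-++ {p = p} p-spanned q-spanned eq c∈ = [ p-spanned eq , q-spanned eq ]′ (∈-++⁻ p c∈)

  module Window {k c : ℕ} (b₀ : ℕ) (fits : k + b₀ ≤ c) where

    shift : Fin k → Fin c
    shift l = fromℕ< (≤-trans (+-monoˡ-< b₀ (toℕ<n l)) fits)

    toℕ-shift : ∀ l → toℕ (shift l) ≡ toℕ l + b₀
    toℕ-shift l = toℕ-fromℕ< _

    window : Vertex a b k → Vertex a b c
    window (x , y , l) = x , y , shift l

    shift-injective : Injective _≡_ _≡_ shift
    shift-injective {l} {l′} eq = toℕ-injective (+-cancelʳ-≡ _ _ _
      (trans (sym (toℕ-shift l)) (trans (cong toℕ eq) (toℕ-shift l′))))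

    window-injective : Injective _≡_ _≡_ window
    window-injective eq =
      cong₂ _,_ (cong proj₁ eq) (cong₂ _,_ (cong (proj₁ ∘ proj₂) eq) (shift-injective (cong (proj₂ ∘ proj₂) eq)))

    ∣shift-shift∣ : ∀ l l′ → ∣ toℕ (shift l) - toℕ (shift l′) ∣ ≡ ∣ toℕ l - toℕ l′ ∣
    ∣shift-shift∣ l l′ rewrite toℕ-shift l | toℕ-shift l′ | +-comm (toℕ l) b₀ | +-comm (toℕ l′) b₀ =
      ∣m+n-m+o∣≡∣n-o∣ b₀ (toℕ l) (toℕ l′)

    window-adjacent : ∀ {u v} → Adj u v → Adj (window u) (window v)
    window-adjacent (inj₁ (d , refl , refl)) = inj₁ (d , refl , refl)
    window-adjacent (inj₂ (inj₁ (refl , d , refl))) = inj₂ (inj₁ (refl , d , refl))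
    window-adjacent {_ , _ , l} {_ , _ , l′} (inj₂ (inj₂ (refl , refl , d))) =
      inj₂ (inj₂ (refl , refl , trans (∣shift-shift∣ l l′) d))

    spreads-window : ∀ {A : List (Vertex a b c)} {ps qs : Vec (Pattern a b) k} → Spreads ps qs →
                     LayersSpanned A b₀ ps → LayersSpanned A b₀ qs
    spreads-window {A} {ps} {qs} (spreads spanned) given l {x} {y} eq xy∈ =
      subst (λ z → Spanned A (x , y , z)) (toℕ-injective (trans (toℕ-shift l) (sym eq)))
        (spanned-image window window-injective window-adjacent seeds (proj₂ (lookup spanned (∈-stack⁺ qs l xy∈))))
      where
      seeds : All (Spanned A ∘ window) (stack ps)
      seeds = tabulate λ { {x , y , l} v∈ → given l (toℕ-shift l) (∈-stack⁻ ps v∈) }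

-- Percolating sets of size σ₂/3 in 3 × 6 × 2(m+1)

open Closure using (spanned-by-closure)

full : Pattern 3 6
full = cartesianProduct (allFin 3) (allFin 6)

∈-full : ∀ c → c ∈ full
∈-full (x , y) = ∈-cartesianProduct⁺ (∈-allFin x) (∈-allFin y)

front : Pattern 3 6
front = filter (λ c → (proj₁ c ≟ᶠ # 2) ⊎-dec (toℕ (proj₂ c) ≤? 3)) full

∅ : Pattern 3 6
∅ = []

lower upper bottom top₀ top₁ : Pattern 3 6
lower = (# 1 , # 2) ∷ (# 2 , # 5) ∷ []
upper = (# 0 , # 1) ∷ (# 1 , # 0) ∷ (# 2 , # 2) ∷ (# 2 , # 4) ∷ []
bottom = (# 0 , # 0) ∷ (# 0 , # 3) ∷ (# 2 , # 0) ∷ (# 2 , # 3) ∷ []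
top₀ = (# 0 , # 5) ∷ []
top₁ = (# 1 , # 5) ∷ []

front-bottom : Spreads ((lower ++ bottom) ∷ upper ∷ lower ∷ []) (∅ ∷ front ∷ ∅ ∷ [])
front-bottom = spreads (spanned-by-closure 10 _)

front-step : Spreads (front ∷ lower ∷ upper ∷ lower ∷ []) (∅ ∷ ∅ ∷ front ∷ ∅ ∷ [])
front-step = spreads (spanned-by-closure 10 _)

full-top : Spreads (front ∷ (lower ++ top₀) ∷ (upper ++ top₁) ∷ []) (∅ ∷ full ∷ full ∷ [])
full-top = spreads (spanned-by-closure 10 _)

full-single : Spreads ((lower ++ bottom ++ top₀) ∷ (upper ++ top₁) ∷ []) (full ∷ full ∷ [])
full-single = spreads (spanned-by-closure 10 _)

full-step : Spreads (front ∷ lower ∷ upper ∷ full ∷ []) (∅ ∷ full ∷ full ∷ ∅ ∷ [])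
full-step = spreads (spanned-by-closure 10 _)

full-bottom : Spreads ((lower ++ bottom) ∷ upper ∷ full ∷ []) (full ∷ full ∷ ∅ ∷ [])
full-bottom = spreads (spanned-by-closure 10 _)

height : ℕ → ℕ
height m = suc m * 2

module Seeds (m : ℕ) where

  -- Wraps around above the height, but is only applied below it.
  layer : ℕ → Fin (height m)
  layer n = n mod height m

  layer-unique : ∀ {n} {z : Fin (height m)} → n < height m → toℕ z ≡ n → z ≡ layer n
  layer-unique n<h eq = toℕ-injective (trans eq (sym (trans (toℕ-fromℕ< _) (m<n⇒m%n≡m n<h))))

  slab : ℕ → List (Vertex 3 6 (height m))
  slab j = map (placeAt (layer (j * 2))) lower ++ map (placeAt (layer (suc (j * 2)))) upper

  slabs : ℕ → List (Vertex 3 6 (height m))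
  slabs zero = slab zero
  slabs (suc j) = slab (suc j) ++ slabs j

  bottoms tops ends : List (Vertex 3 6 (height m))
  bottoms = map (placeAt (layer 0)) bottom
  tops = map (placeAt (layer (m * 2))) top₀ ++ map (placeAt (layer (suc (m * 2)))) top₁
  ends = bottoms ++ tops

  seeds : List (Vertex 3 6 (height m))
  seeds = ends ++ slabs m

  length-seeds : length seeds ≡ 6 + suc m * 6
  length-seeds = cong (6 +_) (length-slabs m)
    where
    length-slabs : ∀ j → length (slabs j) ≡ suc j * 6
    length-slabs zero = refl
    length-slabs (suc j) = cong (6 +_) (length-slabs j)

  slab⊆slabs : ∀ {j k v} → j ≤ k → v ∈ slab j → v ∈ slabs k
  slab⊆slabs {k = zero} z≤n v∈ = v∈
  slab⊆slabs {j} {suc k} j≤k v∈ with j ≟ suc k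
  ... | yes refl = ∈-++⁺ˡ v∈
  ... | no j≢k = ∈-++⁺ʳ (slab (suc k)) (slab⊆slabs (s≤s⁻¹ (≤∧≢⇒< j≤k j≢k)) v∈)

  seeded : ∀ {p n} → n < height m → (∀ {c} → c ∈ p → placeAt (layer n) c ∈ seeds) → LayerSpanned seeds p n
  seeded n<h p⊆seeds eq c∈ rewrite layer-unique n<h eq = 0 , initial (p⊆seeds c∈)

  lower-spanned : ∀ j → j ≤ m → LayerSpanned seeds lower (j * 2)
  lower-spanned j j≤m = seeded (s≤s (m≤n⇒m≤1+n (*-monoˡ-≤ 2 j≤m))) λ c∈ →
    ∈-++⁺ʳ ends (slab⊆slabs j≤m (∈-++⁺ˡ {ys = map (placeAt (layer (suc (j * 2)))) upper}
                                        (∈-map⁺ (placeAt (layer (j * 2))) c∈)))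

  upper-spanned : ∀ j → j ≤ m → LayerSpanned seeds upper (suc (j * 2))
  upper-spanned j j≤m = seeded (s≤s (s≤s (*-monoˡ-≤ 2 j≤m))) λ c∈ →
    ∈-++⁺ʳ ends (slab⊆slabs j≤m (∈-++⁺ʳ (map (placeAt (layer (j * 2))) lower)
                                        (∈-map⁺ (placeAt (layer (suc (j * 2)))) c∈)))

  bottom-spanned : LayerSpanned seeds bottom 0
  bottom-spanned = seeded (s≤s z≤n) λ c∈ →
    ∈-++⁺ˡ {ys = slabs m} (∈-++⁺ˡ {ys = tops} (∈-map⁺ (placeAt (layer 0)) c∈))

  top₀-spanned : LayerSpanned seeds top₀ (m * 2)
  top₀-spanned = seeded (s≤s (n≤1+n _)) λ c∈ →
    ∈-++⁺ˡ {ys = slabs m} (∈-++⁺ʳ bottoms (∈-++⁺ˡ {ys = map (placeAt (layer (suc (m * 2)))) top₁}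
                                                  (∈-map⁺ (placeAt (layer (m * 2))) c∈)))

  top₁-spanned : LayerSpanned seeds top₁ (suc (m * 2))
  top₁-spanned = seeded ≤-refl λ c∈ →
    ∈-++⁺ˡ {ys = slabs m} (∈-++⁺ʳ bottoms (∈-++⁺ʳ (map (placeAt (layer (m * 2))) top₀)
                                                  (∈-map⁺ (placeAt (layer (suc (m * 2)))) c∈)))

  Front : ℕ → Set
  Front j = LayerSpanned seeds front (suc (j * 2))

  Full : ℕ → Set
  Full j = LayerSpanned seeds full (j * 2) × LayerSpanned seeds full (suc (j * 2))

  bottom-window-fits : 1 ≤ m → 3 + 0 ≤ height m
  bottom-window-fits 1≤m = s≤s (s≤s (≤-trans (n≤1+n 1) (*-monoˡ-≤ 2 1≤m)))

  inner-window-fits : ∀ {i} → suc (suc i) ≤ m → 4 + suc (i * 2) ≤ height m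
  inner-window-fits i+2≤m = s≤s (s≤s (≤-trans (n≤1+n _) (*-monoˡ-≤ 2 i+2≤m)))

  front-spanned : ∀ j → suc j ≤ m → Front j
  front-spanned zero 1≤m =
    Window.spreads-window 0 (bottom-window-fits 1≤m) front-bottom
      (λ { zero → LayerSpanned-++ (lower-spanned 0 z≤n) bottom-spanned
         ; (suc zero) → upper-spanned 0 z≤n
         ; (suc (suc zero)) → lower-spanned 1 1≤m })
      (# 1)
  front-spanned (suc i) i+2≤m =
    Window.spreads-window (suc (i * 2)) (inner-window-fits i+2≤m) front-step
      (λ { zero → front-spanned i (<⇒≤ i+2≤m)
         ; (suc zero) → lower-spanned (suc i) (<⇒≤ i+2≤m)
         ; (suc (suc zero)) → upper-spanned (suc i) (<⇒≤ i+2≤m)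
         ; (suc (suc (suc zero))) → lower-spanned (suc (suc i)) i+2≤m })
      (# 2)

  full-below : ∀ j → suc j ≤ m → Full (suc j) → Full j
  full-below zero 1≤m (above , _) = spread (# 0) , spread (# 1)
    where
    spread : LayersSpanned seeds 0 (full ∷ full ∷ ∅ ∷ [])
    spread = Window.spreads-window 0 (bottom-window-fits 1≤m) full-bottom
      λ { zero → LayerSpanned-++ (lower-spanned 0 z≤n) bottom-spanned
        ; (suc zero) → upper-spanned 0 z≤n
        ; (suc (suc zero)) → above }
  full-below (suc i) i+2≤m (above , _) = spread (# 1) , spread (# 2)
    where
    spread : LayersSpanned seeds (suc (i * 2)) (∅ ∷ full ∷ full ∷ ∅ ∷ [])
    spread = Window.spreads-window (suc (i * 2)) (inner-window-fits i+2≤m) full-step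
      λ { zero → front-spanned i (<⇒≤ i+2≤m)
        ; (suc zero) → lower-spanned (suc i) (<⇒≤ i+2≤m)
        ; (suc (suc zero)) → upper-spanned (suc i) (<⇒≤ i+2≤m)
        ; (suc (suc (suc zero))) → above }

full-top-slab : ∀ m → Seeds.Full m m
full-top-slab zero = spread (# 0) , spread (# 1)
  where
  open Seeds zero
  spread : LayersSpanned seeds 0 (full ∷ full ∷ [])
  spread = Window.spreads-window 0 ≤-refl full-single
    λ { zero → LayerSpanned-++ (lower-spanned 0 z≤n) (LayerSpanned-++ bottom-spanned top₀-spanned)
      ; (suc zero) → LayerSpanned-++ (upper-spanned 0 z≤n) top₁-spanned }
full-top-slab (suc m) = spread (# 1) , spread (# 2)
  where
  open Seeds (suc m)
  spread : LayersSpanned seeds (suc (m * 2)) (∅ ∷ full ∷ full ∷ [])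
  spread = Window.spreads-window (suc (m * 2)) ≤-refl full-top
    λ { zero → front-spanned m ≤-refl
      ; (suc zero) → LayerSpanned-++ (lower-spanned (suc m) ≤-refl) top₀-spanned
      ; (suc (suc zero)) → LayerSpanned-++ (upper-spanned (suc m) ≤-refl) top₁-spanned }

full-slab : ∀ m j → j ≤ m → Seeds.Full m j
full-slab m j j≤m = from-top (m ∸ j) (m∸n+n≡m j≤m)
  where
  from-top : ∀ d {j} → d + j ≡ m → Seeds.Full m j
  from-top zero refl = full-top-slab m
  from-top (suc d) {j} d+j≡m =
    Seeds.full-below m j (subst (suc j ≤_) d+j≡m (s≤s (m≤n+m j d))) (from-top d (trans (+-suc d j) d+j≡m))

even-or-odd : ∀ n → ∃[ j ] (n ≡ j * 2 ⊎ n ≡ suc (j * 2))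
even-or-odd zero = 0 , inj₁ refl
even-or-odd (suc n) with even-or-odd n
... | j , inj₁ refl = j , inj₂ refl
... | j , inj₂ refl = suc j , inj₁ refl

slab-below-height : ∀ m j → j * 2 < height m → Seeds.Full m j
slab-below-height m j lt = full-slab m j (s≤s⁻¹ (*-cancelʳ-< 2 j (suc m) lt))

percolates : ∀ m → Percolates (Seeds.seeds m)
percolates m (x , y , z) with even-or-odd (toℕ z)
... | j , inj₁ even =
  proj₁ (slab-below-height m j (subst (_< height m) even (toℕ<n z))) even (∈-full (x , y))
... | j , inj₂ odd =
  proj₂ (slab-below-height m j (subst (_≤ height m) odd (≤-trans (n≤1+n _) (toℕ<n z)))) odd (∈-full (x , y))

proposition5p10 : (a₃ : ℕ) → 2 ≤ a₃ → 2 ∣ a₃ → Perfect 3 6 a₃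
proposition5p10 _ () (divides zero refl)
proposition5p10 _ _ (divides (suc m) refl) =
  perfect (Seeds.seeds m) (percolates m) (trans (σ₂-3-6 m) (cong (_* 3) (sym (Seeds.length-seeds m))))
  where
  σ₂-3-6 : ∀ m → 3 * 6 + 3 * (suc m * 2) + 6 * (suc m * 2) ≡ (6 + suc m * 6) * 3
  σ₂-3-6 = solve-∀
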